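{- Let $k$ be a positive integer and let $G$ be a graph that does not contain $K_k$ as a topological minor. Let $(T,\beta)$ be a tree decomposition of $G$ as provided by the Grohe–Marx decomposition theorem. Consider any run of the Construction on $G$, let $1\le i<\ell$, let $C$ be a component of $G_i$, and let $H_{i_1},\ldots,H_{i_s}$ be the subgraphs among $H_1,\ldots,H_i$ that are connected to $C$. Then there is a node $t\in V(T)$ such that $\beta(t)$ intersects $V(H_{i_j})$ for every $1\le j\le s$.
   Context: A tree decomposition of $G$ is a pair $(T,\beta)$ with $T$ a tree and $\beta:V(T)\to 2^{V(G)}$ such that for every $v\in V(G)$ the set $\{t:v\in\beta(t)\}$ is non-empty and connected in $T$, and every edge of $G$ is contained in some $\beta(t)$. Its adhesion is $\max\{|\beta(s)\cap\beta(t)|:st\in E(T)\}$. The torso at $t$ is $G[\beta(t)]$ together with all edges making each $\beta(s)\cap\beta(t)$, $st\in E(T)$, a clique. Grohe–Marx decomposition theorem: for every $k$ there are constants $a(k),c(k),d(k),e(k)$ such that every graph excluding $K_k$ as a topological minor has a tree decomposition of adhesion at most $a(k)$ in which every node's torso either has at most $c(k)$ vertices of degree larger than $d(k)$, or excludes $K_{e(k)}$ as a minor. $K_k$ is a topological minor of $G$ if there are $k$ distinct vertices and pairwise internally vertex-disjoint paths connecting every pair of them. Construction. One iteratively builds pairwise vertex-disjoint connected subgraphs $H_1,\ldots,H_\ell$ covering $V(G)$. Let $G_i:=G-\bigcup_{j\le i}V(H_j)$. A component $C$ of $G_i$ is connected to $H_j$ ($j\le i$) if some edge of $G$ joins $V(H_j)$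 and $V(C)$. Start with $H_1:=G[\{v\}]$ for an arbitrary $v$. Given $H_1,\ldots,H_i$ not covering $V(G)$, fix a component $C$ of $G_i$, let $H_{i_1},\ldots,H_{i_s}$ be the subgraphs connected to $C$ (they are pairwise joined by edges of $G$), for $v\in V(C)$ let $m_i(v)$ be the maximum number of paths connecting $v$ with distinct $H_{i_j}$, with internal vertices in $G_i$, pairwise disjoint apart from $v$; choose $v\in V(C)$ maximising $m_i(v)$, take a BFS tree of $C$ rooted at $v$, and let $H_{i+1}$ be a minimal connected subtree of it containing $v$ and, for each $j$, a vertex of $C$ adjacent to $H_{i_j}$. Open choices are arbitrary. -}

module Defs where

open import Data.Nat using (ℕ; zero; suc; _≤_; _<_)
open import Data.Fin as F using (Fin)
open import Data.Fin.Subset using (Subset; _∈_; _∉_; _∩_; ∣_∣; ⁅_⁆; _⊆_; ⊤)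
open import Data.List using (List; []; _∷_; length)
open import Data.List.Membership.Propositional using () renaming (_∈_ to _∈ₗ_)
open import Data.List.Relation.Unary.All using (All)
open import Data.List.Relation.Unary.Unique.Propositional using (Unique)
open import Data.Product using (Σ; ∃; ∃₂; _×_; _,_)
open import Data.Sum using (_⊎_)
open import Data.Empty using (⊥)
open import Relation.Nullary using (¬_)
open import Relation.Binary.PropositionalEquality using (_≡_; _≢_)

Rel : ℕ → Set₁
Rel n = Fin n → Fin n → Set

record Graph : Set₁ where
  field
    n        : ℕ
    E        : Rel n
    E-sym    : ∀ {u v} → E u v → E v u
    E-irrefl : ∀ {u} → ¬ E u u

data Walk {n : ℕ} (R : Rel n) : Fin n → Fin n → List (Fin n) → Set where
  stop : ∀ u → Walk R u u (u ∷ [])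
  step : ∀ {u v w xs} → R u v → Walk R v w xs → Walk R u w (u ∷ xs)

IsPath : ∀ {n} → Rel n → Fin n → Fin n → List (Fin n) → Set
IsPath R u w xs = Walk R u w xs × Unique xs

Interior : ∀ {n} → Fin n → Fin n → List (Fin n) → Fin n → Set
Interior u w xs x = x ∈ₗ xs × x ≢ u × x ≢ w

ConnectedIn : ∀ {n} → Rel n → Subset n → Set
ConnectedIn R S = ∀ {u w} → u ∈ S → w ∈ S →
  ∃ λ xs → Walk R u w xs × All (_∈ S) xs

Acyclic : ∀ {n} → Rel n → Set
Acyclic R = ∀ {u w xs} → IsPath R u w xs → 3 ≤ length xs → ¬ R w u

IsTreeOn : ∀ {n} → Rel n → Subset n → Set
IsTreeOn R S = (∀ {u v} → R u v → u ∈ S × v ∈ S) × ConnectedIn R S × Acyclic R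

record TopMinor (G : Graph) (k : ℕ) : Set where
  open Graph G
  field
    branch     : Fin k → Fin n
    branch-inj : ∀ p q → branch p ≡ branch q → p ≡ q
    path       : (p q : Fin k) → p F.< q → List (Fin n)
    path-ok    : ∀ p q (h : p F.< q) → IsPath E (branch p) (branch q) (path p q h)
    avoid      : ∀ p q (h : p F.< q) x → Interior (branch p) (branch q) (path p q h) x →
                 ∀ r → x ≢ branch r
    disjoint   : ∀ p q (h : p F.< q) p' q' (h' : p' F.< q') → (p ≢ p' ⊎ q ≢ q') →
                 ∀ x → Interior (branch p) (branch q) (path p q h) x →
                 Interior (branch p') (branch q') (path p' q' h') x → ⊥

record CliqueMinorIn {n : ℕ} (R : Rel n) (S : Subset n) (e : ℕ) : Set where
  field
    X         : Fin e → Subset n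
    nonempty  : ∀ a → ∃ λ u → u ∈ X a
    inside    : ∀ a → X a ⊆ S
    connected : ∀ a → ConnectedIn R (X a)
    disjoint  : ∀ a b → a ≢ b → ∀ x → x ∈ X a → x ∉ X b
    adjacent  : ∀ a b → a ≢ b → ∃₂ λ u w → u ∈ X a × w ∈ X b × R u w

record TreeDecomposition (G : Graph) : Set₁ where
  open Graph G
  field
    m        : ℕ
    TE       : Rel m
    TE-sym   : ∀ {s t} → TE s t → TE t s
    TE-irr   : ∀ {t} → ¬ TE t t
    m≥1      : 1 ≤ m
    tree     : IsTreeOn TE ⊤
    β        : Fin m → Subset n
    covers   : ∀ v → ∃ λ t → v ∈ β t
    vconn    : ∀ v {s t} → v ∈ β s → v ∈ β t →
               ∃ λ ts → Walk TE s t ts × All (λ r → v ∈ β r) ts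
    edges    : ∀ {u v} → E u v → ∃ λ t → u ∈ β t × v ∈ β t

  TorsoE : Fin m → Rel n
  TorsoE t u v = u ∈ β t × v ∈ β t × u ≢ v ×
                 (E u v ⊎ ∃ λ s → TE s t × u ∈ β s × v ∈ β s)

  TorsoDeg≤ : Fin m → Fin n → ℕ → Set
  TorsoDeg≤ t u d = ∃ λ (N : List (Fin n)) → length N ≤ d × (∀ w → TorsoE t u w → w ∈ₗ N)

  FewHighDeg : Fin m → ℕ → ℕ → Set
  FewHighDeg t c d = ∃ λ (L : List (Fin n)) → length L ≤ c ×
                     (∀ u → u ∈ β t → ¬ (u ∈ₗ L) → TorsoDeg≤ t u d)

-- a tree decomposition with the properties of the Grohe–Marx theorem
-- for the constants a = a(k), c = c(k), d = d(k), e = e(k)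
record GroheMarx (G : Graph) (a c d e : ℕ) : Set₁ where
  field
    dec : TreeDecomposition G
  open TreeDecomposition dec public
  field
    adhesion : ∀ s t → TE s t → ∣ β s ∩ β t ∣ ≤ a
    torsos   : ∀ t → FewHighDeg t c d ⊎ ¬ CliqueMinorIn (TorsoE t) (β t) e

-- The Construction (indices 1..ℓ; H j is the vertex set of H_j)

module Construction (G : Graph) (H : ℕ → Subset (Graph.n G)) where
  open Graph G

  Covered : ℕ → Fin n → Set
  Covered i v = ∃ λ j → 1 ≤ j × j ≤ i × v ∈ H j

  -- C is (the vertex set of) a component of G_i
  IsComponent : ℕ → Subset n → Set
  IsComponent i C = (∃ λ u → u ∈ C) × (∀ u → u ∈ C → ¬ Covered i u) × ConnectedIn E C ×
                    (∀ u w → u ∈ C → ¬ Covered i w → E u w → w ∈ C)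

  ConnTo : ℕ → ℕ → Subset n → Set
  ConnTo i j C = 1 ≤ j × j ≤ i × ∃₂ λ u w → u ∈ H j × w ∈ C × E u w

  -- m_i(v) ≥ r: there are r paths from v to distinct H_{i_j}, internal
  -- vertices in G_i, pairwise disjoint apart from v
  record Admits (i : ℕ) (C : Subset n) (v : Fin n) (r : ℕ) : Set where
    field
      target     : Fin r → ℕ
      target-inj : ∀ a b → target a ≡ target b → a ≡ b
      target-con : ∀ a → ConnTo i (target a) C
      endv       : Fin r → Fin n
      endv-in    : ∀ a → endv a ∈ H (target a)
      path       : Fin r → List (Fin n)
      path-ok    : ∀ a → IsPath E v (endv a) (path a)
      internal   : ∀ a x → Interior v (endv a) (path a) x → ¬ Covered i x
      disjoint   : ∀ a b → a ≢ b → ∀ x → x ∈ₗ path a → x ∈ₗ path b → x ≡ v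

  IsBFSTree : Subset n → Fin n → Rel n → Set
  IsBFSTree C v B = (∀ {u w} → B u w → E u w) × (∀ {u w} → B u w → B w u) ×
                    IsTreeOn B C ×
                    (∀ u → u ∈ C → ∃ λ xs → Walk B v u xs ×
                       (∀ ys → Walk E v u ys → All (_∈ C) ys → length xs ≤ length ys))

  record Step (i : ℕ) : Set₁ where
    field
      C        : Subset n
      C-comp   : IsComponent i C
      v        : Fin n
      v∈C      : v ∈ C
      v-max    : ∀ w → w ∈ C → ∀ r → Admits i C w r → Admits i C v r
      B        : Rel n
      B-bfs    : IsBFSTree C v B
      x        : (j : ℕ) → ConnTo i j C → Fin n
      x∈C      : ∀ j h → x j h ∈ C
      x-adj    : ∀ j h → ∃ λ u → u ∈ H j × E u (x j h)
      v∈H      : v ∈ H (suc i)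
      x∈H      : ∀ j h → x j h ∈ H (suc i)
      H⊆C      : H (suc i) ⊆ C
      H-conn   : ConnectedIn B (H (suc i))
      H-min    : ∀ Y → Y ⊆ H (suc i) → v ∈ Y → (∀ j h → x j h ∈ Y) →
                 ConnectedIn B Y → H (suc i) ⊆ Y

record Run (G : Graph) : Set₁ where
  open Graph G
  field
    ℓ     : ℕ
    H     : ℕ → Subset n
  open Construction G H public
  field
    ℓ≥1   : 1 ≤ ℓ
    start : ∃ λ v → H 1 ≡ ⁅ v ⁆
    steps : ∀ i → 1 ≤ i → i < ℓ → Step i
    cover : ∀ v → Covered ℓ v

-- For a connected vertex set X the nodes whose bags meet X form a subtree of T.
-- Each H_j' with j' ≥ 2 is grown inside the component of G_(j'-1) containing C,
-- so it contains a neighbour of every earlier H_j connected to C: the subtrees of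
-- the H_j connected to C pairwise intersect, and the Helly property of subtrees
-- gives a common node.
module Submission where

open import Defs
open import Data.Nat using (ℕ; zero; suc; _≤_; _<_; z≤n; s≤s; s≤s⁻¹; _≤?_; _<?_)
open import Data.Nat.Properties using (≤-trans; <⇒≤; ≤-<-trans; m<1+n⇒m<n∨m≡n)
open import Data.Fin as F using (Fin; _≟_)
open import Data.Fin.Properties using (any?)
open import Data.Fin.Subset using (Subset; _∈_; _⊆_; ⊤)
open import Data.Fin.Subset.Properties using (_∈?_; _⊆?_; ∈⊤; x∈⁅x⁆; x∈⁅y⁆⇒x≡y)
open import Data.List using (_∷_; length)
open import Data.List.Membership.Propositional using () renaming (_∈_ to _∈ₗ_)
import Data.List.Membership.DecPropositional as DecMembership
open import Data.List.Relation.Unary.Any using (here; there)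
open import Data.List.Relation.Unary.All as All using (All; []; _∷_)
open import Data.List.Relation.Unary.All.Properties using (¬Any⇒All¬)
open import Data.List.Relation.Unary.AllPairs using ([]; _∷_)
open import Data.List.Relation.Unary.Unique.Propositional using (Unique)
open import Data.Product using (∃; ∃₂; _×_; _,_; proj₁; proj₂)
open import Data.Sum as Sum using (_⊎_; inj₁; inj₂)
open import Data.Unit using (tt)
open import Data.Empty using (⊥; ⊥-elim)
open import Function using (case_of_)
open import Relation.Nullary using (¬_; yes; no)
open import Relation.Nullary.Decidable using (_×-dec_)
open import Relation.Unary using (Decidable; U)
open import Relation.Binary using (Symmetric)
open import Relation.Binary.PropositionalEquality using (_≡_; _≢_; refl; sym; subst)

WalkWithin : ∀ {n} → Rel n → (Fin n → Set) → Fin n → Fin n → Set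
WalkWithin R P u w = ∃ λ xs → Walk R u w xs × All P xs

Connected : ∀ {n} → Rel n → (Fin n → Set) → Set
Connected R P = ∀ {u w} → P u → P w → WalkWithin R P u w

walk-map : ∀ {n} {R R′ : Rel n} → (∀ {x y} → R x y → R′ x y) →
           ∀ {u w xs} → Walk R u w xs → Walk R′ u w xs
walk-map f (stop u)   = stop u
walk-map f (step r p) = step (f r) (walk-map f p)

module _ {n : ℕ} {R : Rel n} where

  walk-head : ∀ {P : Fin n → Set} {u w xs} → Walk R u w xs → All P xs → P u
  walk-head (stop _)   (pu ∷ _) = pu
  walk-head (step _ _) (pu ∷ _) = pu

  walk-nonempty : ∀ {u w xs} → Walk R u w xs → 1 ≤ length xs
  walk-nonempty (stop _)   = s≤s z≤n
  walk-nonempty (step _ _) = s≤s z≤n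

  walkWithin-map : ∀ {P Q : Fin n → Set} → (∀ {x} → P x → Q x) →
                   ∀ {u w} → WalkWithin R P u w → WalkWithin R Q u w
  walkWithin-map f (xs , p , ps) = xs , p , All.map f ps

  walkWithin-++ : ∀ {P : Fin n → Set} {u v w} →
                  WalkWithin R P u v → WalkWithin R P v w → WalkWithin R P u w
  walkWithin-++ {P} {v = v} {w} (_ , p , ps) q = go p ps
    where
    go : ∀ {u xs} → Walk R u v xs → All P xs → WalkWithin R P u w
    go (stop _)   _        = q
    go (step r p) (pu ∷ ps) with go p ps
    ... | _ , pq , pqs = _ , step r pq , pu ∷ pqs

  walkWithin-reverse : Symmetric R → ∀ {P : Fin n → Set} {u w} →
                       WalkWithin R P u w → WalkWithin R P w u
  walkWithin-reverse R-sym {P} (_ , p , ps) = go p ps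
    where
    go : ∀ {u w xs} → Walk R u w xs → All P xs → WalkWithin R P w u
    go (stop u)   ps        = _ , stop u , ps
    go (step r p) (pu ∷ ps) =
      walkWithin-++ (go p ps) (_ , step (R-sym r) (stop _) , walk-head p ps ∷ pu ∷ [])

  open DecMembership (_≟_ {n}) using () renaming (_∈?_ to _∈ₗ?_)

  path-suffix : ∀ {u v w ys} → IsPath R v w ys → u ∈ₗ ys → ∃ λ zs → IsPath R u w zs
  path-suffix (stop _ , unique)       (here refl)  = _ , stop _ , unique
  path-suffix (step r p , unique)     (here refl)  = _ , step r p , unique
  path-suffix (step _ p , _ ∷ unique) (there u∈ys) = path-suffix (p , unique) u∈ys
  path-suffix (stop _ , _)            (there ())

  walk⇒path : ∀ {u w xs} → Walk R u w xs → ∃ λ ys → IsPath R u w ys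
  walk⇒path (stop u) = _ , stop u , [] ∷ []
  walk⇒path (step {u} r p) with walk⇒path p
  ... | ys , q , unique with u ∈ₗ? ys
  ...   | yes u∈ys = path-suffix (q , unique) u∈ys
  ...   | no  u∉ys = u ∷ ys , step r q , ¬Any⇒All¬ ys u∉ys ∷ unique

module TreeProperties {m : ℕ} {T : Rel m} (T-sym : Symmetric T) (T-irrefl : ∀ {t} → ¬ T t t)
                      (T-acyclic : Acyclic T) (T-connected : ConnectedIn T ⊤) where

  Cut : Fin m → Fin m → Rel m
  Cut a b u v = T u v × ¬ (u ≡ a × v ≡ b) × ¬ (u ≡ b × v ≡ a)

  Cut-sym : ∀ {a b} → Symmetric (Cut a b)
  Cut-sym (r , ¬ab , ¬ba) =
    T-sym r , (λ (v≡a , u≡b) → ¬ba (u≡b , v≡a)) , (λ (v≡b , u≡a) → ¬ab (u≡a , v≡b))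

  -- x is on the side of c once the edge ab is cut (c is a or b)
  Beside : Fin m → Fin m → Fin m → Fin m → Set
  Beside a b c x = WalkWithin (Cut a b) U x c

  beside-step : ∀ {a b c x v} → Cut a b x v → Beside a b c v → Beside a b c x
  beside-step r (_ , q , us) = _ , step r q , tt ∷ us

  cut-disconnects : ∀ {a b xs} → T a b → ¬ Walk (Cut a b) a b xs
  cut-disconnects ab p with walk⇒path p
  ... | _ , stop _ , _                       = T-irrefl ab
  ... | _ , step (_ , ¬ab , _) (stop _) , _  = ¬ab (refl , refl)
  ... | _ , step r (step r′ q) , unique      =
    T-acyclic (walk-map proj₁ (step r (step r′ q)) , unique)
              (s≤s (s≤s (walk-nonempty q))) (T-sym ab)

  beside-either : ∀ a b x → Beside a b a x ⊎ Beside a b b x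
  beside-either a b x with T-connected {x} {a} ∈⊤ ∈⊤
  ... | _ , p , _ = go p
    where
    go : ∀ {x xs} → Walk T x a xs → Beside a b a x ⊎ Beside a b b x
    go (stop _) = inj₁ (_ , stop _ , tt ∷ [])
    go {x} (step r p) with x ≟ a | x ≟ b
    ... | yes refl | _        = inj₁ (_ , stop _ , tt ∷ [])
    ... | no _     | yes refl = inj₂ (_ , stop _ , tt ∷ [])
    ... | no x≢a   | no x≢b   = Sum.map (beside-step cut) (beside-step cut) (go p)
      where
      cut : Cut a b x _
      cut = r , (λ e → x≢a (proj₁ e)) , (λ e → x≢b (proj₁ e))

  beside-unique : ∀ {a b x} → T a b → Beside a b a x → Beside a b b x → ⊥
  beside-unique ab xa xb with walkWithin-++ (walkWithin-reverse Cut-sym xa) xb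
  ... | _ , p , _ = cut-disconnects ab p

  crossing : ∀ {a b x y} (S : Fin m → Set) → T a b → WalkWithin T S x y →
             Beside a b a x → Beside a b b y → S a × S b
  crossing {a} {b} S ab (_ , p , ps) = go p ps
    where
    go : ∀ {x y xs} → Walk T x y xs → All S xs → Beside a b a x → Beside a b b y → S a × S b
    go (stop _) _ xa yb = ⊥-elim (beside-unique ab xa yb)
    go {x} (step {v = v} r p) (Sx ∷ ps) xa yb with (x ≟ a) ×-dec (v ≟ b)
    ... | yes (refl , refl) = Sx , walk-head p ps
    ... | no ¬ab with (x ≟ b) ×-dec (v ≟ a)
    ...   | yes (refl , refl) = walk-head p ps , Sx
    ...   | no ¬ba = go p ps (beside-step (Cut-sym (r , ¬ab , ¬ba)) xa) yb

  walk-avoiding : ∀ {a b x y xs} → Walk T x y xs → All (a ≢_) xs → Walk (Cut a b) x y xs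
  walk-avoiding (stop _) _ = stop _
  walk-avoiding (step r p) (a≢x ∷ ps) =
    step (r , (λ e → a≢x (sym (proj₁ e))) , (λ e → walk-head p ps (sym (proj₂ e))))
         (walk-avoiding p ps)

  projection : (K : Fin m → Set) → Decidable K → Connected T K → ∀ t {u} → K u →
               ∃ λ t* → K t* × (∀ S → Connected T S → S t → (∃ λ w → S w × K w) → S t*)
  projection K K? K-connected t Ku with T-connected {t} ∈⊤ ∈⊤
  ... | _ , p , _ with walk⇒path p
  ...   | _ , path , unique = along path unique Ku
    where
    along : ∀ {t u xs} → Walk T t u xs → Unique xs → K u →
            ∃ λ t* → K t* × (∀ S → Connected T S → S t → (∃ λ w → S w × K w) → S t*)
    along {t} p unique Ku with K? t
    ... | yes Kt = t , Kt , λ _ _ St _ → St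
    along (stop _) _ Ku | no ¬Kt = ⊥-elim (¬Kt Ku)
    along {t} {u} (step {v = t′} tt′ p) (t∉p ∷ unique) Ku | no ¬Kt with along p unique Ku
    ... | t* , Kt* , through =
      t* , Kt* , λ S S-connected St meet → through S S-connected (next S S-connected St meet) meet
      where
      u-beside-t′ : Beside t t′ t′ u
      u-beside-t′ = walkWithin-reverse Cut-sym (_ , walk-avoiding p t∉p , All.universal-U _)

      -- K avoids t, so it lies on the side of t′; S joins t to K, so it crosses tt′.
      next : ∀ S → Connected T S → S t → (∃ λ w → S w × K w) → S t′
      next S S-connected St (w , Sw , Kw) with beside-either t t′ w
      ... | inj₁ w-beside-t  =
        ⊥-elim (¬Kt (proj₁ (crossing K tt′ (K-connected Kw Ku) w-beside-t u-beside-t′)))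
      ... | inj₂ w-beside-t′ =
        proj₂ (crossing S tt′ (S-connected St Sw) (_ , stop t , tt ∷ []) w-beside-t′)

  -- Helly property of subtrees. The relevant indices Q need not be decidable: the
  -- common node is moved at every index of a decidable D ⊇ Q.
  helly : (S : ℕ → Fin m → Set) (Q D : ℕ → Set) → (∀ {j} → Q j → D j) → Decidable D →
          (∀ {j} → D j → Connected T (S j)) → (∀ {j} → D j → Decidable (S j)) →
          (∀ {j} → D j → ∃ (S j)) →
          (∀ {j j′} → j < j′ → Q j → D j′ → ∃ λ t → S j t × S j′ t) →
          Fin m → ∀ b → ∃ λ t → ∀ {j} → j < b → Q j → S j t
  helly S Q D Q⇒D D? connected decidable nonempty meet t₀ = go
    where
    go : ∀ b → ∃ λ t → ∀ {j} → j < b → Q j → S j t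
    go zero = t₀ , λ ()
    go (suc b) with go b | D? b
    ... | t , common | no ¬Db = t , λ j<1+b Qj → case m<1+n⇒m<n∨m≡n j<1+b of λ where
      (inj₁ j<b)  → common j<b Qj
      (inj₂ refl) → ⊥-elim (¬Db (Q⇒D Qj))
    ... | t , common | yes Db with projection (S b) (decidable Db) (connected Db) t
                                              (proj₂ (nonempty Db))
    ...   | t* , St* , through = t* , λ j<1+b Qj → case m<1+n⇒m<n∨m≡n j<1+b of λ where
      (inj₁ j<b)  → through _ (connected (Q⇒D Qj)) (common j<b Qj) (meet j<b Qj Db)
      (inj₂ refl) → St*

module BagProperties {G : Graph} (TD : TreeDecomposition G) where
  open Graph G
  open TreeDecomposition TD

  BagMeets : Subset n → Fin m → Set
  BagMeets X t = ∃ λ u → u ∈ β t × u ∈ X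

  bagMeets? : ∀ X → Decidable (BagMeets X)
  bagMeets? X t = any? λ u → (u ∈? β t) ×-dec (u ∈? X)

  bagMeets-connected : ∀ {X} → ConnectedIn E X → Connected TE (BagMeets X)
  bagMeets-connected {X} X-connected (u₁ , u₁∈β , u₁∈X) (u₂ , u₂∈β , u₂∈X)
    with X-connected u₁∈X u₂∈X
  ... | _ , p , ps = go p ps u₁∈β u₂∈β
    where
    go : ∀ {u₁ u₂ xs t₁ t₂} → Walk E u₁ u₂ xs → All (_∈ X) xs → u₁ ∈ β t₁ → u₂ ∈ β t₂ →
         WalkWithin TE (BagMeets X) t₁ t₂
    go (stop u) (u∈X ∷ _) u∈β₁ u∈β₂ =
      walkWithin-map (λ u∈β → u , u∈β , u∈X) (vconn u u∈β₁ u∈β₂)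
    go {u₁} (step e p) (u₁∈X ∷ ps) u₁∈β₁ u₂∈β₂ with edges e
    ... | s , u₁∈βs , v∈βs =
      walkWithin-++ (walkWithin-map (λ u₁∈β → u₁ , u₁∈β , u₁∈X) (vconn u₁ u₁∈β₁ u₁∈βs))
                    (go p ps v∈βs u₂∈β₂)

  bagMeets-nonempty : ∀ {X u} → u ∈ X → ∃ (BagMeets X)
  bagMeets-nonempty {u = u} u∈X with covers u
  ... | t , u∈β = t , u , u∈β , u∈X

  adjacent⇒bagsMeet : ∀ {X Y u w} → u ∈ X → w ∈ Y → E u w →
                      ∃ λ t → BagMeets X t × BagMeets Y t
  adjacent⇒bagsMeet u∈X w∈Y e with edges e
  ... | t , u∈β , w∈β = t , (_ , u∈β , u∈X) , (_ , w∈β , w∈Y)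

module RunProperties {G : Graph} (R : Run G) where
  open Graph G
  open Run R

  stepAt : ∀ p → suc p < ℓ → Step (suc p)
  stepAt p = steps (suc p) (s≤s z≤n)

  H-nonempty : ∀ {j} → 1 ≤ j → j < ℓ → ∃ λ v → v ∈ H j
  H-nonempty {suc zero} _ _ with start
  ... | v , H₁≡⁅v⁆ = v , subst (v ∈_) (sym H₁≡⁅v⁆) (x∈⁅x⁆ v)
  H-nonempty {suc (suc p)} _ j<ℓ = _ , Step.v∈H (stepAt p (<⇒≤ j<ℓ))

  H-connected : ∀ {j} → 1 ≤ j → j < ℓ → ConnectedIn E (H j)
  H-connected {suc zero} _ _ {u} {w} u∈H₁ w∈H₁ with start
  ... | v , H₁≡⁅v⁆
    with x∈⁅y⁆⇒x≡y v (subst (u ∈_) H₁≡⁅v⁆ u∈H₁) | x∈⁅y⁆⇒x≡y v (subst (w ∈_) H₁≡⁅v⁆ w∈H₁)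
  ... | refl | refl = _ , stop v , u∈H₁ ∷ []
  H-connected {suc (suc p)} _ j<ℓ u∈H w∈H =
    let xs , q , qs = Step.H-conn st u∈H w∈H in xs , walk-map (proj₁ (Step.B-bfs st)) q , qs
    where
    st : Step (suc p)
    st = stepAt p (<⇒≤ j<ℓ)

  uncovered-mono : ∀ {p q v} → p ≤ q → ¬ Covered q v → ¬ Covered p v
  uncovered-mono p≤q ¬cov (j , 1≤j , j≤p , v∈H) = ¬cov (j , 1≤j , ≤-trans j≤p p≤q , v∈H)

  component-closed : ∀ {p K x y} → IsComponent p K → x ∈ K →
                     WalkWithin E (λ v → ¬ Covered p v) x y → y ∈ K
  component-closed {p} {K} (_ , _ , _ , closed) x∈K (_ , q , qs) = go q qs x∈K
    where
    go : ∀ {x y xs} → Walk E x y xs → All (λ v → ¬ Covered p v) xs → x ∈ K → y ∈ K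
    go (stop _) _ x∈K = x∈K
    go (step e q) (_ ∷ qs) x∈K = go q qs (closed _ _ x∈K (walk-head q qs) e)

  -- the component H_j was grown in (junk value ⊤ when there is none)
  grownIn : ℕ → Subset n
  grownIn zero = ⊤
  grownIn (suc zero) = ⊤
  grownIn (suc (suc p)) with suc p <? ℓ
  ... | yes p<ℓ = Step.C (stepAt p p<ℓ)
  ... | no _    = ⊤

  component-⊆-grownIn : ∀ {i j C} → i < ℓ → IsComponent i C → ConnTo i j C → C ⊆ grownIn j
  component-⊆-grownIn {j = zero} _ _ _ _ = ∈⊤
  component-⊆-grownIn {j = suc zero} _ _ _ _ = ∈⊤
  component-⊆-grownIn {i} {suc (suc p)} {C} i<ℓ (_ , C-uncovered , C-connected , _)
                      (_ , j≤i , u , w , u∈H , w∈C , uw) {c} c∈C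
    with suc p <? ℓ
  ... | no p≮ℓ = ⊥-elim (p≮ℓ (≤-<-trans (<⇒≤ j≤i) i<ℓ))
  ... | yes p<ℓ with C-connected w∈C c∈C
  ...   | _ , q , qs =
    component-closed (Step.C-comp st) u∈C′
      (_ , step uw q , uncovered u∈C′ ∷ All.map (λ x∈C → uncovered-mono p<i (C-uncovered _ x∈C)) qs)
    where
    st : Step (suc p)
    st = stepAt p p<ℓ
    p<i : p < i
    p<i = <⇒≤ j≤i
    u∈C′ : u ∈ Step.C st
    u∈C′ = Step.H⊆C st u∈H
    uncovered : ∀ {x} → x ∈ Step.C st → ¬ Covered (suc p) x
    uncovered = proj₁ (proj₂ (Step.C-comp st)) _

  step-adjacent : ∀ {p j} (st : Step p) → ConnTo p j (Step.C st) →
                  ∃₂ λ u w → u ∈ H j × w ∈ H (suc p) × E u w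
  step-adjacent st conn with Step.x-adj st _ conn
  ... | u , u∈H , e = u , Step.x st _ conn , u∈H , Step.x∈H st _ conn , e

  connTo-adjacent : ∀ {i j j′ C} → j′ < ℓ → ConnTo i j C → j < j′ → C ⊆ grownIn j′ →
                    ∃₂ λ u w → u ∈ H j × w ∈ H j′ × E u w
  connTo-adjacent {j′ = suc zero} _ (s≤s _ , _) (s≤s ()) _
  connTo-adjacent {j = j} {suc (suc p)} j′<ℓ (1≤j , _ , u , w , u∈H , w∈C , uw) j<j′ C⊆
    with suc p <? ℓ
  ... | no p≮ℓ = ⊥-elim (p≮ℓ (<⇒≤ j′<ℓ))
  ... | yes p<ℓ = step-adjacent (stepAt p p<ℓ) (1≤j , s≤s⁻¹ j<j′ , u , w , u∈H , C⊆ w∈C , uw)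

lemma15 : (k : ℕ) → 1 ≤ k → (G : Graph) → ¬ TopMinor G k →
          (a c d e : ℕ) → (D : GroheMarx G a c d e) →
          (R : Run G) → (i : ℕ) → 1 ≤ i → i < Run.ℓ R →
          (C : Subset (Graph.n G)) → Run.IsComponent R i C →
          ∃ λ t → ∀ j → Run.ConnTo R i j C →
            ∃ λ u → u ∈ GroheMarx.β D t × u ∈ Run.H R j
lemma15 _ _ G _ _ _ _ _ D R i _ i<ℓ C C-comp =
  proj₁ common-node , λ j conn → proj₂ common-node (s≤s (proj₁ (proj₂ conn))) conn
  where
  open Run R
  open RunProperties R
  open GroheMarx D using (dec; m≥1; TE-sym; TE-irr; tree)
  open BagProperties dec
  open TreeProperties TE-sym TE-irr (proj₂ (proj₂ tree)) (proj₁ (proj₂ tree)) using (helly)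

  Candidate : ℕ → Set
  Candidate j = 1 ≤ j × j ≤ i × C ⊆ grownIn j

  common-node : ∃ λ t → ∀ {j} → j < suc i → ConnTo i j C → BagMeets (H j) t
  common-node = helly (λ j → BagMeets (H j)) (λ j → ConnTo i j C) Candidate
    (λ conn@(1≤j , j≤i , _) → 1≤j , j≤i , component-⊆-grownIn i<ℓ C-comp conn)
    (λ j → (1 ≤? j) ×-dec (j ≤? i) ×-dec (C ⊆? grownIn j))
    (λ (1≤j , j≤i , _) → bagMeets-connected (H-connected 1≤j (≤-<-trans j≤i i<ℓ)))
    (λ _ → bagMeets? _)
    (λ (1≤j , j≤i , _) → bagMeets-nonempty (proj₂ (H-nonempty 1≤j (≤-<-trans j≤i i<ℓ))))
    (λ j<j′ conn (_ , j′≤i , C⊆) →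
      let _ , _ , u∈H , w∈H , e = connTo-adjacent (≤-<-trans j′≤i i<ℓ) conn j<j′ C⊆
      in adjacent⇒bagsMeet u∈H w∈H e)
    (F.fromℕ< m≥1) (suc i)
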